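{- The sign pattern $\begin{bmatrix}-&+&0\\-&0&+\\+&0&0\end{bmatrix}$ requires algebraic positivity.
   Context: For a sign pattern $S$ (matrix with entries in $\{+,-,0\}$), $Q(S)$ is the set of real matrices $X$ with $\mathrm{sgn}(X_{ij})=S_{ij}$ for all $i,j$. A real square matrix $M$ is algebraically positive if there is a real polynomial $p$ with all entries of $p(M)$ positive. $S$ requires algebraic positivity if every $X\in Q(S)$ is algebraically positive. -}

module Defs where

open import Level using (0ℓ)
open import Data.Nat using (ℕ; zero; suc)
open import Data.Fin using (Fin; zero; suc)
open import Data.List using (List; []; _∷_)
open import Data.Product using (Σ; ∃; _×_; _,_)
open import Data.Sum using (_⊎_)
open import Relation.Binary.PropositionalEquality using (_≡_; _≢_)
open import Relation.Binary.Structures using (IsStrictTotalOrder)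
open import Algebra.Structures using (IsCommutativeRing)

-- The real numbers, axiomatised as a complete ordered field
-- (unique up to isomorphism, so any model is "the" reals).
record Reals : Set₁ where
  infixl 6 _+_
  infixl 7 _*_
  infix 4 _<_ _≤_
  field
    ℝ : Set
    _+_ _*_ : ℝ → ℝ → ℝ
    -_ : ℝ → ℝ
    0r 1r : ℝ
    _<_ : ℝ → ℝ → Set
    isCommutativeRing : IsCommutativeRing _≡_ _+_ _*_ -_ 0r 1r
    0≢1 : 0r ≢ 1r
    inverse : ∀ x → x ≢ 0r → Σ ℝ λ y → x * y ≡ 1r
    isStrictTotalOrder : IsStrictTotalOrder _≡_ _<_
    +-mono-< : ∀ {x y} z → x < y → x + z < y + z
    *-pos : ∀ {x y} → 0r < x → 0r < y → 0r < x * y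
  _≤_ : ℝ → ℝ → Set
  x ≤ y = x < y ⊎ x ≡ y
  field
    complete : (P : ℝ → Set) → Σ ℝ P → Σ ℝ (λ b → ∀ x → P x → x ≤ b) →
               Σ ℝ λ s → (∀ x → P x → x ≤ s) ×
                         (∀ b → (∀ x → P x → x ≤ b) → s ≤ b)

data Sign : Set where
  ⊕ ⊖ ⊙ : Sign

SignPattern : ℕ → Set
SignPattern n = Fin n → Fin n → Sign

module RealMatrices (R : Reals) where
  open Reals R

  Matrix : ℕ → Set
  Matrix n = Fin n → Fin n → ℝ

  HasSign : ℝ → Sign → Set
  HasSign x ⊕ = 0r < x
  HasSign x ⊖ = x < 0r
  HasSign x ⊙ = x ≡ 0r

  InQ : ∀ {n} → SignPattern n → Matrix n → Set
  InQ S X = ∀ i j → HasSign (X i j) (S i j)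

  sumFin : ∀ n → (Fin n → ℝ) → ℝ
  sumFin zero f = 0r
  sumFin (suc n) f = f zero + sumFin n (λ i → f (suc i))

  _·_ : ∀ {n} → Matrix n → Matrix n → Matrix n
  _·_ {n} A B i j = sumFin n λ k → A i k * B k j

  identity : ∀ {n} → Matrix n
  identity zero zero = 1r
  identity zero (suc j) = 0r
  identity (suc i) zero = 0r
  identity (suc i) (suc j) = identity i j

  -- Real polynomial given by its coefficient list c₀ ∷ c₁ ∷ … (c₀ + c₁ t + …),
  -- evaluated at a matrix by Horner's rule: p(M) = c₀ I + M · (rest)(M).
  evalPoly : ∀ {n} → List ℝ → Matrix n → Matrix n
  evalPoly [] M i j = 0r
  evalPoly (c ∷ cs) M i j = c * identity i j + (M · evalPoly cs M) i j

  AlgebraicallyPositive : ∀ {n} → Matrix n → Set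
  AlgebraicallyPositive M = Σ (List ℝ) λ p → ∀ i j → 0r < evalPoly p M i j

  RequiresAlgebraicPositivity : ∀ {n} → SignPattern n → Set
  RequiresAlgebraicPositivity S = ∀ X → InQ S X → AlgebraicallyPositive X

S₆ : SignPattern 3
S₆ zero zero = ⊖
S₆ zero (suc zero) = ⊕
S₆ zero (suc (suc zero)) = ⊙
S₆ (suc zero) zero = ⊖
S₆ (suc zero) (suc zero) = ⊙
S₆ (suc zero) (suc (suc zero)) = ⊕
S₆ (suc (suc zero)) zero = ⊕
S₆ (suc (suc zero)) (suc zero) = ⊙
S₆ (suc (suc zero)) (suc (suc zero)) = ⊙

module Submission where

-- Every X ∈ Q(S₆) has the form
--
--        ⎡ -a  b  0 ⎤
--    X = ⎢ -c  0  d ⎥        with a, b, c, d, e > 0,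
--        ⎣  e  0  0 ⎦
--
-- and for such X the quadratic polynomial
--
--    p(t) = (2ade + 2bc²) + (2ac + de) t + 2c t²
--
-- gives a matrix p(X) each of whose entries is a sum of products of a, …, e
-- (see closedForm below), hence positive.  So X is algebraically positive,
-- with a polynomial depending on X.

open import Defs
open import Level using (Level; 0ℓ)
open import Data.Nat as ℕ using (ℕ; zero; suc)
open import Data.Fin using (Fin; zero; suc)
open import Data.List using (List; []; _∷_)
open import Data.Vec using (Vec; _∷_; [])
open import Data.Product using (_,_)
open import Data.Maybe using (Maybe; just; nothing)
open import Data.Integer as ℤ using (ℤ; +_; -[1+_])
import Data.Integer.Properties as ℤP
import Data.Nat.Properties as ℕP
import Data.Sign as Sign
open import Relation.Nullary using (yes; no)
open import Relation.Binary.PropositionalEquality as ≡ using (_≡_)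
open import Relation.Binary.Structures using (IsStrictTotalOrder)
open import Algebra.Bundles using (CommutativeRing; RawRing)
open import Algebra.Solver.Ring.AlmostCommutativeRing
  using (fromCommutativeRing; _-Raw-AlmostCommutative⟶_)
import Algebra.Solver.Ring as RingSolver
import Algebra.Properties.Ring as RingProperties
import Algebra.Properties.Semiring.Mult.TCOptimised as Multiples
import Algebra.Properties.CommutativeSemigroup as CommutativeSemigroupProperties
import Relation.Binary.Reasoning.Setoid as SetoidReasoning

pattern ₀ = zero
pattern ₁ = suc zero
pattern ₂ = suc (suc zero)

-- Integer coefficients are what let the solver see cancellations such as
-- 2a²c - 2a²c = 0.
module IntegerCoefficients {ℓ₁ ℓ₂ : Level} (R : CommutativeRing ℓ₁ ℓ₂) where
  open CommutativeRing R
  open RingProperties ring using (-1*x≈-x; -‿involutive; -0#≈0#; -‿+-comm)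
  open Multiples semiring using (_×_; 1+×; ×-homo-+; ×1-homo-*)
  open CommutativeSemigroupProperties +-commutativeSemigroup
    using () renaming (interchange to +-interchange)
  open CommutativeSemigroupProperties *-commutativeSemigroup
    using () renaming (interchange to *-interchange)
  open SetoidReasoning setoid

  -- n ↦ 1 + ⋯ + 1 (n summands); with this version of _×_, 1 × 1# is 1#.
  natural : ℕ → Carrier
  natural n = n × 1#

  ⟦_⟧ℤ : ℤ → Carrier
  ⟦ + n ⟧ℤ = natural n
  ⟦ -[1+ n ] ⟧ℤ = - natural (suc n)

  signed : Sign.Sign → Carrier
  signed Sign.+ = 1#
  signed Sign.- = - 1#

  signed-homo : ∀ s t → signed (s Sign.* t) ≈ signed s * signed t
  signed-homo Sign.+ Sign.+ = sym (*-identityˡ 1#)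
  signed-homo Sign.+ Sign.- = sym (*-identityˡ (- 1#))
  signed-homo Sign.- Sign.+ = sym (*-identityʳ (- 1#))
  signed-homo Sign.- Sign.- = begin
    1#            ≈⟨ -‿involutive 1# ⟨
    - (- 1#)      ≈⟨ -1*x≈-x (- 1#) ⟨
    - 1# * - 1#   ∎

  ◃-homo : ∀ s n → ⟦ s ℤ.◃ n ⟧ℤ ≈ signed s * natural n
  ◃-homo s zero = sym (zeroʳ (signed s))
  ◃-homo Sign.+ (suc n) = sym (*-identityˡ _)
  ◃-homo Sign.- (suc n) = sym (-1*x≈-x _)

  sign-abs : ∀ i → ⟦ i ⟧ℤ ≈ signed (ℤ.sign i) * natural ℤ.∣ i ∣
  sign-abs (+ n) = sym (*-identityˡ _)
  sign-abs -[1+ n ] = sym (-1*x≈-x _)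

  *-homo : ∀ i j → ⟦ i ℤ.* j ⟧ℤ ≈ ⟦ i ⟧ℤ * ⟦ j ⟧ℤ
  *-homo i j = begin
    ⟦ i ℤ.* j ⟧ℤ
      ≈⟨ ◃-homo (ℤ.sign i Sign.* ℤ.sign j) (ℤ.∣ i ∣ ℕ.* ℤ.∣ j ∣) ⟩
    signed (ℤ.sign i Sign.* ℤ.sign j) * natural (ℤ.∣ i ∣ ℕ.* ℤ.∣ j ∣)
      ≈⟨ *-cong (signed-homo (ℤ.sign i) (ℤ.sign j)) (×1-homo-* ℤ.∣ i ∣ ℤ.∣ j ∣) ⟩
    (signed (ℤ.sign i) * signed (ℤ.sign j)) * (natural ℤ.∣ i ∣ * natural ℤ.∣ j ∣)
      ≈⟨ *-interchange _ _ _ _ ⟩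
    (signed (ℤ.sign i) * natural ℤ.∣ i ∣) * (signed (ℤ.sign j) * natural ℤ.∣ j ∣)
      ≈⟨ *-cong (sign-abs i) (sign-abs j) ⟨
    ⟦ i ⟧ℤ * ⟦ j ⟧ℤ ∎

  cancel-one : ∀ x y → (1# + x) + - (1# + y) ≈ x + - y
  cancel-one x y = begin
    (1# + x) + - (1# + y)   ≈⟨ +-congˡ (-‿+-comm 1# y) ⟨
    (1# + x) + (- 1# + - y) ≈⟨ +-interchange 1# x (- 1#) (- y) ⟩
    (1# + - 1#) + (x + - y) ≈⟨ +-congʳ (-‿inverseʳ 1#) ⟩
    0# + (x + - y)          ≈⟨ +-identityˡ _ ⟩
    x + - y                 ∎

  -- The difference of two naturals is preserved; addition of integers
  -- reduces to this in the mixed-sign cases.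
  ⊖-homo : ∀ m n → ⟦ m ℤ.⊖ n ⟧ℤ ≈ natural m + - natural n
  ⊖-homo zero zero = sym (trans (+-congˡ -0#≈0#) (+-identityʳ 0#))
  ⊖-homo (suc m) zero = sym (trans (+-congˡ -0#≈0#) (+-identityʳ _))
  ⊖-homo zero (suc n) = sym (+-identityˡ _)
  ⊖-homo (suc m) (suc n) = begin
    ⟦ suc m ℤ.⊖ suc n ⟧ℤ                  ≡⟨ ≡.cong ⟦_⟧ℤ (ℤP.[1+m]⊖[1+n]≡m⊖n m n) ⟩
    ⟦ m ℤ.⊖ n ⟧ℤ                          ≈⟨ ⊖-homo m n ⟩
    natural m + - natural n               ≈⟨ cancel-one _ _ ⟨
    (1# + natural m) + - (1# + natural n) ≈⟨ +-cong (1+× m 1#) (-‿cong (1+× n 1#)) ⟨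
    natural (suc m) + - natural (suc n)   ∎

  +-homo : ∀ i j → ⟦ i ℤ.+ j ⟧ℤ ≈ ⟦ i ⟧ℤ + ⟦ j ⟧ℤ
  +-homo (+ m) (+ n) = ×-homo-+ 1# m n
  +-homo (+ m) -[1+ n ] = ⊖-homo m (suc n)
  +-homo -[1+ m ] (+ n) = trans (⊖-homo n (suc m)) (+-comm _ _)
  +-homo -[1+ m ] -[1+ n ] = begin
    - natural (suc (suc (m ℕ.+ n)))      ≡⟨ ≡.cong (λ k → - natural k) (ℕP.+-suc (suc m) n) ⟨
    - natural (suc m ℕ.+ suc n)          ≈⟨ -‿cong (×-homo-+ 1# (suc m) (suc n)) ⟩
    - (natural (suc m) + natural (suc n)) ≈⟨ -‿+-comm _ _ ⟨
    - natural (suc m) + - natural (suc n) ∎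

  -‿homo : ∀ i → ⟦ ℤ.- i ⟧ℤ ≈ - ⟦ i ⟧ℤ
  -‿homo (+ zero) = sym -0#≈0#
  -‿homo (+ suc n) = refl
  -‿homo -[1+ n ] = sym (-‿involutive _)

  homomorphism : CommutativeRing.rawRing ℤP.+-*-commutativeRing
                   -Raw-AlmostCommutative⟶ fromCommutativeRing R
  homomorphism = record
    { ⟦_⟧ = ⟦_⟧ℤ ; +-homo = +-homo ; *-homo = *-homo ; -‿homo = -‿homo
    ; 0-homo = refl ; 1-homo = refl }

  -- Equal integers have equal images (all the solver needs to compare
  -- coefficients).
  equalImages? : ∀ i j → Maybe (⟦ i ⟧ℤ ≈ ⟦ j ⟧ℤ)
  equalImages? i j with i ℤ.≟ j
  ... | yes ≡.refl = just refl
  ... | no _ = nothing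

  open RingSolver (CommutativeRing.rawRing ℤP.+-*-commutativeRing)
                  (fromCommutativeRing R) homomorphism equalImages?
    public using (Polynomial; con; var; _:+_; _:*_; :-_; ⟦_⟧; ⟦_⟧↓; prove)

-- The matrices of Q(S₆), the certificate polynomial and the closed form of
-- its value, written over an arbitrary raw ring so that they can be read
-- both as real numbers and as solver expressions.
module Certificate {ℓ₁ ℓ₂ : Level} (A : RawRing ℓ₁ ℓ₂) where
  open RawRing A

  shape : (a b c d e : Carrier) → Fin 3 → Fin 3 → Carrier
  shape a b c d e ₀ ₀ = - a
  shape a b c d e ₀ ₁ = b
  shape a b c d e ₀ ₂ = 0#
  shape a b c d e ₁ ₀ = - c
  shape a b c d e ₁ ₁ = 0#
  shape a b c d e ₁ ₂ = d
  shape a b c d e ₂ ₀ = e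
  shape a b c d e ₂ ₁ = 0#
  shape a b c d e ₂ ₂ = 0#

  double : Carrier → Carrier
  double x = x + x

  constantTerm linearTerm : (a b c d e : Carrier) → Carrier
  constantTerm a b c d e = double (a * (d * e)) + double (b * (c * c))
  linearTerm a b c d e = double (a * c) + d * e

  certificate : (a b c d e : Carrier) → List Carrier
  certificate a b c d e =
    constantTerm a b c d e ∷ linearTerm a b c d e ∷ double c ∷ []

  closedForm : (a b c d e : Carrier) → Fin 3 → Fin 3 → Carrier
  closedForm a b c d e ₀ ₀ = a * (d * e)
  closedForm a b c d e ₀ ₁ = b * (d * e)
  closedForm a b c d e ₀ ₂ = b * (d * double c)
  closedForm a b c d e ₁ ₀ = c * (d * e)
  closedForm a b c d e ₁ ₁ = double (a * (d * e))
  closedForm a b c d e ₁ ₂ = d * linearTerm a b c d e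
  closedForm a b c d e ₂ ₀ = d * (e * e)
  closedForm a b c d e ₂ ₁ = b * (e * double c)
  closedForm a b c d e ₂ ₂ = constantTerm a b c d e

-- Square-matrix arithmetic over a raw ring, clause for clause the same as
-- in RealMatrices; over solver expressions it denotes exactly the real
-- computation, which is what lets the solver verify p(X) entrywise.
module MatrixArithmetic {ℓ₁ ℓ₂ : Level} (A : RawRing ℓ₁ ℓ₂) where
  open RawRing A

  identity : ∀ {n} → Fin n → Fin n → Carrier
  identity zero zero = 1#
  identity zero (suc j) = 0#
  identity (suc i) zero = 0#
  identity (suc i) (suc j) = identity i j

  sumFin : ∀ n → (Fin n → Carrier) → Carrier
  sumFin zero f = 0#
  sumFin (suc n) f = f zero + sumFin n (λ i → f (suc i))

  _·_ : ∀ {n} → (Fin n → Fin n → Carrier) → (Fin n → Fin n → Carrier) →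
        Fin n → Fin n → Carrier
  _·_ {n} M N i j = sumFin n λ k → M i k * N k j

  evalPoly : ∀ {n} → List Carrier → (Fin n → Fin n → Carrier) → Fin n → Fin n → Carrier
  evalPoly [] M i j = 0#
  evalPoly (c ∷ cs) M i j = c * identity i j + (M · evalPoly cs M) i j

module CertifiedPositivity (R : Reals) where
  open Reals R
  open RealMatrices R

  ℝ-ring : CommutativeRing 0ℓ 0ℓ
  ℝ-ring = record { isCommutativeRing = isCommutativeRing }

  open CommutativeRing ℝ-ring using (+-identityˡ; -‿inverseʳ; rawRing)
  open RingProperties (CommutativeRing.ring ℝ-ring) using (-‿involutive)
  open IntegerCoefficients ℝ-ring
  open Certificate rawRing public using (shape; certificate; closedForm)

  Term : Set
  Term = Polynomial 5

  termRing : RawRing 0ℓ 0ℓ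
  termRing = record
    { Carrier = Term ; _≈_ = _≡_ ; _+_ = _:+_ ; _*_ = _:*_ ; -_ = :-_
    ; 0# = con (+ 0) ; 1# = con (+ 1) }

  module Symbolic where
    open Certificate termRing public
    open MatrixArithmetic termRing public

  closedForm-correct : ∀ a b c d e i j →
    evalPoly (certificate a b c d e) (shape a b c d e) i j ≡ closedForm a b c d e i j
  closedForm-correct a b c d e = λ where
      ₀ ₀ → byRing ₀ ₀ ≡.refl ; ₀ ₁ → byRing ₀ ₁ ≡.refl ; ₀ ₂ → byRing ₀ ₂ ≡.refl
      ₁ ₀ → byRing ₁ ₀ ≡.refl ; ₁ ₁ → byRing ₁ ₁ ≡.refl ; ₁ ₂ → byRing ₁ ₂ ≡.refl
      ₂ ₀ → byRing ₂ ₀ ≡.refl ; ₂ ₁ → byRing ₂ ₁ ≡.refl ; ₂ ₂ → byRing ₂ ₂ ≡.refl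
    where
    ρ : Vec ℝ 5
    ρ = a ∷ b ∷ c ∷ d ∷ e ∷ []

    a′ b′ c′ d′ e′ : Term
    a′ = var ₀
    b′ = var ₁
    c′ = var ₂
    d′ = var (suc ₂)
    e′ = var (suc (suc ₂))

    lhs rhs : Fin 3 → Fin 3 → Term
    lhs = Symbolic.evalPoly (Symbolic.certificate a′ b′ c′ d′ e′)
                            (Symbolic.shape a′ b′ c′ d′ e′)
    rhs = Symbolic.closedForm a′ b′ c′ d′ e′

    -- The solver compares normal forms (here: ≡.refl); the denotations of lhs
    -- and rhs at ρ are, definitionally, the two sides of the real identity.
    byRing : ∀ i j → ⟦ lhs i j ⟧↓ ρ ≡ ⟦ rhs i j ⟧↓ ρ → ⟦ lhs i j ⟧ ρ ≡ ⟦ rhs i j ⟧ ρ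
    byRing i j = prove ρ (lhs i j) (rhs i j)

  +-pos : ∀ {x y} → 0r < x → 0r < y → 0r < x + y
  +-pos {x} {y} 0<x 0<y =
    IsStrictTotalOrder.trans isStrictTotalOrder 0<y
      (≡.subst (_< x + y) (+-identityˡ y) (+-mono-< y 0<x))

  double-pos : ∀ {x} → 0r < x → 0r < x + x
  double-pos 0<x = +-pos 0<x 0<x

  neg-pos : ∀ {x} → x < 0r → 0r < - x
  neg-pos {x} x<0 = ≡.subst₂ _<_ (-‿inverseʳ x) (+-identityˡ (- x)) (+-mono-< (- x) x<0)

  -- Every entry of the closed form is built from a, …, e by + and *.
  closedForm-positive : ∀ {a b c d e} →
    0r < a → 0r < b → 0r < c → 0r < d → 0r < e →
    ∀ i j → 0r < closedForm a b c d e i j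
  closedForm-positive pa pb pc pd pe = λ where
      ₀ ₀ → ade
      ₀ ₁ → *-pos pb de
      ₀ ₂ → *-pos pb (*-pos pd (double-pos pc))
      ₁ ₀ → *-pos pc de
      ₁ ₁ → double-pos ade
      ₁ ₂ → *-pos pd (+-pos (double-pos (*-pos pa pc)) de)
      ₂ ₀ → *-pos pd (*-pos pe pe)
      ₂ ₁ → *-pos pb (*-pos pe (double-pos pc))
      ₂ ₂ → +-pos (double-pos ade) (double-pos (*-pos pb (*-pos pc pc)))
    where
    de = *-pos pd pe
    ade = *-pos pa de

  inQ-shape : ∀ X → InQ S₆ X →
    ∀ i j → X i j ≡ shape (- X ₀ ₀) (X ₀ ₁) (- X ₁ ₀) (X ₁ ₂) (X ₂ ₀) i j
  inQ-shape X X∈Q = λ where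
    ₀ ₀ → ≡.sym (-‿involutive _) ; ₀ ₁ → ≡.refl ; ₀ ₂ → X∈Q ₀ ₂
    ₁ ₀ → ≡.sym (-‿involutive _) ; ₁ ₁ → X∈Q ₁ ₁ ; ₁ ₂ → ≡.refl
    ₂ ₀ → ≡.refl ; ₂ ₁ → X∈Q ₂ ₁ ; ₂ ₂ → X∈Q ₂ ₂

  sumFin-cong : ∀ n {f g : Fin n → ℝ} → (∀ k → f k ≡ g k) → sumFin n f ≡ sumFin n g
  sumFin-cong zero f≡g = ≡.refl
  sumFin-cong (suc n) f≡g = ≡.cong₂ _+_ (f≡g zero) (sumFin-cong n (λ k → f≡g (suc k)))

  evalPoly-cong : ∀ {n} p {M N : Matrix n} → (∀ i j → M i j ≡ N i j) →
    ∀ i j → evalPoly p M i j ≡ evalPoly p N i j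
  evalPoly-cong [] M≡N i j = ≡.refl
  evalPoly-cong {n} (c ∷ cs) M≡N i j =
    ≡.cong (λ s → c * identity i j + s)
      (sumFin-cong n (λ k → ≡.cong₂ _*_ (M≡N i k) (evalPoly-cong cs M≡N k j)))

mainTheorem6 : (R : Reals) → RealMatrices.RequiresAlgebraicPositivity R S₆
mainTheorem6 R X X∈Q = certificate a b c d e , p[X]-positive
  where
  open Reals R
  open RealMatrices R
  open CertifiedPositivity R

  a b c d e : ℝ
  a = - X ₀ ₀
  b = X ₀ ₁
  c = - X ₁ ₀
  d = X ₁ ₂
  e = X ₂ ₀

  p[X]-positive : ∀ i j → 0r < evalPoly (certificate a b c d e) X i j
  p[X]-positive i j =
    ≡.subst (0r <_)
      (≡.sym (≡.trans (evalPoly-cong (certificate a b c d e) (inQ-shape X X∈Q) i j)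
                      (closedForm-correct a b c d e i j)))
      (closedForm-positive (neg-pos (X∈Q ₀ ₀)) (X∈Q ₀ ₁) (neg-pos (X∈Q ₁ ₀))
                           (X∈Q ₁ ₂) (X∈Q ₂ ₀) i j)
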